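{- Let $\mathcal{R}$ be a Dedekind domain and $\mathcal{I}\subsetneq\mathcal{R}$ an ideal. Let $n>1$ be an integer and $(x_1,\ldots,x_n)\in\mathcal{R}^n$ with $\langle x_1\rangle+\cdots+\langle x_n\rangle+\mathcal{I}=\mathcal{R}$. Then there exist $a_1,\ldots,a_n\in\mathcal{R}$ with $\langle a_1\rangle+\cdots+\langle a_n\rangle=\mathcal{R}$ and $a_1x_1+\cdots+a_nx_n\in 1+\mathcal{I}$ (i.e. $\mathcal{R}$ satisfies the choice multiplier hypothesis for $(x_1,\ldots,x_n)$ with respect to $\mathcal{I}$). -}

module Defs where

open import Level using (Level; _⊔_; suc)
open import Data.Nat using (ℕ; zero) renaming (suc to sucℕ)
open import Data.Fin using (Fin) renaming (zero to fzero; suc to fsuc)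
open import Data.Product using (Σ; ∃; _×_; _,_)
open import Data.Sum using (_⊎_)
open import Relation.Nullary using (¬_)
open import Algebra.Bundles using (CommutativeRing)

module _ {c ℓ : Level} (R : CommutativeRing c ℓ) where
  open CommutativeRing R

  ∑ : (n : ℕ) → (Fin n → Carrier) → Carrier
  ∑ zero    f = 0#
  ∑ (sucℕ n) f = f fzero + ∑ n (λ i → f (fsuc i))

  pow : Carrier → ℕ → Carrier
  pow a zero     = 1#
  pow a (sucℕ n) = a * pow a n

  _∣ᴿ_ : Carrier → Carrier → Set (c ⊔ ℓ)
  b ∣ᴿ a = Σ Carrier (λ q → a ≈ b * q)

  record Ideal (p : Level) : Set (c ⊔ ℓ ⊔ suc p) where
    field
      _∈ᴵ_    : Carrier → Set p
      ∈-resp  : ∀ {a b} → a ≈ b → _∈ᴵ_ a → _∈ᴵ_ b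
      0∈      : _∈ᴵ_ 0#
      +∈      : ∀ {a b} → _∈ᴵ_ a → _∈ᴵ_ b → _∈ᴵ_ (a + b)
      *∈      : ∀ r {a} → _∈ᴵ_ a → _∈ᴵ_ (r * a)
  open Ideal public

  Proper : ∀ {p} → Ideal p → Set p
  Proper I = ¬ (_∈ᴵ_ I 1#)

  ∈⟨_⟩+_ : ∀ {p} {n : ℕ} → (Fin n → Carrier) → Ideal p → Carrier → Set (c ⊔ ℓ ⊔ p)
  ∈⟨_⟩+_ {n = n} x I r =
    Σ (Fin n → Carrier) λ s → Σ Carrier λ i → _∈ᴵ_ I i × (r ≈ ∑ n (λ j → s j * x j) + i)

  ∈⟨_⟩ : {n : ℕ} → (Fin n → Carrier) → Carrier → Set (c ⊔ ℓ)
  ∈⟨_⟩ {n} x r = Σ (Fin n → Carrier) λ s → r ≈ ∑ n (λ j → s j * x j)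

  IsPrimeIdeal : ∀ {p} → Ideal p → Set (c ⊔ p)
  IsPrimeIdeal P = Proper P × (∀ a b → _∈ᴵ_ P (a * b) → _∈ᴵ_ P a ⊎ _∈ᴵ_ P b)

  IsMaximalIdeal : ∀ {p} → Ideal p → Set (c ⊔ ℓ ⊔ suc p)
  IsMaximalIdeal {p} P = Proper P ×
    ((J : Ideal p) → (∀ r → _∈ᴵ_ P r → _∈ᴵ_ J r) →
       (∀ r → _∈ᴵ_ J r → _∈ᴵ_ P r) ⊎ (∀ r → _∈ᴵ_ J r))

  IsNonzeroIdeal : ∀ {p} → Ideal p → Set (c ⊔ ℓ ⊔ p)
  IsNonzeroIdeal P = Σ Carrier λ a → _∈ᴵ_ P a × ¬ (a ≈ 0#)

  record IsDedekindDomain : Set (suc (c ⊔ ℓ)) where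
    field
      1≉0         : ¬ (1# ≈ 0#)
      noZeroDiv   : ∀ a b → a * b ≈ 0# → a ≈ 0# ⊎ b ≈ 0#
      noetherian  : (J : Ideal (c ⊔ ℓ)) →
                    Σ ℕ λ n → Σ (Fin n → Carrier) λ g →
                      ∀ r → (_∈ᴵ_ J r → ∈⟨ g ⟩ r) × (∈⟨ g ⟩ r → _∈ᴵ_ J r)
      -- integrally closed: if a/b (b ≠ 0) is a root of a monic polynomial
      -- tⁿ + cₙ₋₁ tⁿ⁻¹ + ⋯ + c₀ over R, i.e.
      -- aⁿ + Σ_{i<n} cᵢ aⁱ bⁿ⁻ⁱ = 0, then a/b ∈ R, i.e. b ∣ a
      intClosed   : ∀ a b → ¬ (b ≈ 0#) → (n : ℕ) → (cs : Fin n → Carrier) →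
                    pow a n + ∑ n (λ i → cs i * (pow a (Data.Fin.toℕ i) *
                                         pow b (n Data.Nat.∸ Data.Fin.toℕ i))) ≈ 0# →
                    b ∣ᴿ a
      primeMax    : (P : Ideal (c ⊔ ℓ)) → IsNonzeroIdeal P → IsPrimeIdeal P →
                    IsMaximalIdeal P

{-# OPTIONS --safe #-}
-- Write 1 = Σ sⱼ xⱼ + i with i ∈ I.  If i = 0 then s itself works.  Otherwise R/iR has Krull
-- dimension 0, hence stable range 1: for b = Σ_{j>0} sⱼ xⱼ some r makes u = s₀ + r b a unit
-- modulo i.  Modulo i the row t = (u, (1 − r x₀) s₁, (1 − r x₀) s₂, …) is an elementary
-- transformation of s, so Σ tⱼ xⱼ ≡ Σ sⱼ xⱼ ≡ 1 (mod I).  Replacing 1 − r x₀ by (1 − r x₀) p u,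
-- where p u + q i = 1, and adding i to t₁ keeps this congruence and makes ⟨t₀, t₁⟩ = R.
--
-- The classical ingredients are recovered constructively from Noetherianity: finite generation
-- of the ideal {r ∣ P ⊎ r ≈ 0} decides P, ascending chains of ideals stabilise, and so a greedy
-- chain produces a prime ideal avoiding any given multiplicative set.
module Submission where

open import Defs
open import Level using (Level; _⊔_; Lift; lift)
open import Data.Nat using (ℕ; zero; suc; _<_; _≤_; _≤′_; ≤′-refl; ≤′-step; s≤s)
  renaming (_⊔_ to _⊔ℕ_; _+_ to _+ℕ_)
open import Data.Nat.Properties using (≤⇒≤′; m≤m⊔n; m≤n⊔m; ≤-trans)
open import Data.Fin using (Fin) renaming (zero to fzero; suc to fsuc)
open import Data.Vec.Functional using (Vector; _∷_; []; tail)
open import Data.Product using (Σ; _×_; _,_; proj₁; proj₂)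
open import Data.Sum using (_⊎_; inj₁; inj₂; [_,_]′)
open import Data.Empty using (⊥; ⊥-elim)
open import Function using (id; _∘_)
open import Relation.Nullary using (¬_; Dec; yes; no)
import Relation.Binary.PropositionalEquality as ≡
open import Algebra.Bundles using (CommutativeRing)

∀⊎⇒⊎∀ : ∀ {a b} {A : Set a} {n} {B : Fin n → Set b} → (∀ j → A ⊎ B j) → A ⊎ (∀ j → B j)
∀⊎⇒⊎∀ {n = zero}  f = inj₂ λ ()
∀⊎⇒⊎∀ {n = suc n} f with f fzero | ∀⊎⇒⊎∀ (f ∘ fsuc)
... | inj₁ a  | _       = inj₁ a
... | inj₂ _  | inj₁ a  = inj₁ a
... | inj₂ b₀ | inj₂ bs = inj₂ λ { fzero → b₀ ; (fsuc j) → bs j }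

upperBound : ∀ {n} (f : Fin n → ℕ) → Σ ℕ λ M → ∀ j → f j ≤ M
upperBound {zero}  f = 0 , λ ()
upperBound {suc n} f with upperBound (f ∘ fsuc)
... | M , f≤M = f fzero ⊔ℕ M , λ { fzero    → m≤m⊔n _ M
                               ; (fsuc j) → ≤-trans (f≤M j) (m≤n⊔m (f fzero) M) }

module RingTheory {c ℓ : Level} (R : CommutativeRing c ℓ) where
  open CommutativeRing R
  open import Algebra.Properties.Semiring.Sum semiring
    using (sum; sum-cong-≋; sum-replicate-zero; *-distribˡ-sum) renaming (∑-distrib-+ to sum-distrib-+)
  open import Algebra.Properties.Semiring.Exp semiring using (_^_)
  open import Algebra.Properties.Ring ring using (-1*x≈-x)
  open import Algebra.Properties.CommutativeSemigroup *-commutativeSemigroup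
    using () renaming (interchange to *-interchange)
  open import Algebra.Properties.Group +-group using (\\-leftDividesʳ; //-rightDividesʳ)
  open import Relation.Binary.Reasoning.Setoid setoid
  open import Algebra.Solver.Ring.NaturalCoefficients.Default commutativeSemiring

  L : Level
  L = c ⊔ ℓ

  ∑≡sum : ∀ n (f : Vector Carrier n) → ∑ R n f ≡.≡ sum f
  ∑≡sum zero    f = ≡.refl
  ∑≡sum (suc n) f = ≡.cong (f fzero +_) (∑≡sum n (tail f))

  ∑-cong : ∀ {n} {f g : Vector Carrier n} → (∀ j → f j ≈ g j) → ∑ R n f ≈ ∑ R n g
  ∑-cong {n} {f} {g} f≈g = begin
    ∑ R n f  ≡⟨ ∑≡sum n f ⟩
    sum f    ≈⟨ sum-cong-≋ f≈g ⟩
    sum g    ≡⟨ ∑≡sum n g ⟨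
    ∑ R n g  ∎

  ∑-zero : ∀ n → ∑ R n (λ _ → 0#) ≈ 0#
  ∑-zero n = trans (reflexive (∑≡sum n _)) (sum-replicate-zero n)

  ∑-zeroˡ : ∀ n (g : Vector Carrier n) → ∑ R n (λ j → 0# * g j) ≈ 0#
  ∑-zeroˡ n g = trans (∑-cong (λ j → zeroˡ (g j))) (∑-zero n)

  ∑-distrib-+ : ∀ n (f g : Vector Carrier n) → ∑ R n (λ j → f j + g j) ≈ ∑ R n f + ∑ R n g
  ∑-distrib-+ n f g = begin
    ∑ R n (λ j → f j + g j)  ≡⟨ ∑≡sum n _ ⟩
    sum (λ j → f j + g j)    ≈⟨ sum-distrib-+ f g ⟩
    sum f + sum g            ≡⟨ ≡.cong₂ _+_ (∑≡sum n f) (∑≡sum n g) ⟨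
    ∑ R n f + ∑ R n g        ∎

  *-distribˡ-∑ : ∀ n x (f : Vector Carrier n) → x * ∑ R n f ≈ ∑ R n (λ j → x * f j)
  *-distribˡ-∑ n x f = begin
    x * ∑ R n f              ≡⟨ ≡.cong (x *_) (∑≡sum n f) ⟩
    x * sum f                ≈⟨ *-distribˡ-sum x f ⟩
    sum (λ j → x * f j)      ≡⟨ ∑≡sum n _ ⟨
    ∑ R n (λ j → x * f j)    ∎

  infix 4 _∈_ _⊆_

  _∈_ : ∀ {p} → Carrier → Ideal R p → Set p
  r ∈ I = _∈ᴵ_ I r

  _⊆_ : ∀ {p q} → Ideal R p → Ideal R q → Set (c ⊔ p ⊔ q)
  I ⊆ J = ∀ {r} → r ∈ I → r ∈ J

  module _ {p} (I : Ideal R p) where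

    ∑-∈ : ∀ n {f : Vector Carrier n} → (∀ j → f j ∈ I) → ∑ R n f ∈ I
    ∑-∈ zero    f∈ = 0∈ I
    ∑-∈ (suc n) f∈ = +∈ I (f∈ fzero) (∑-∈ n (f∈ ∘ fsuc))

    -‿∈ : ∀ {x} → x ∈ I → - x ∈ I
    -‿∈ {x} x∈ = ∈-resp I (-1*x≈-x x) (*∈ I (- 1#) x∈)

    +∈-cancelˡ : ∀ {x y} → x + y ∈ I → x ∈ I → y ∈ I
    +∈-cancelˡ {x} {y} x+y∈ x∈ = ∈-resp I (\\-leftDividesʳ x y) (+∈ I (-‿∈ x∈) x+y∈)

    +∈-cancelʳ : ∀ {x y} → x + y ∈ I → y ∈ I → x ∈ I
    +∈-cancelʳ {x} {y} x+y∈ y∈ = ∈-resp I (//-rightDividesʳ y x) (+∈ I x+y∈ (-‿∈ y∈))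

    *∈ʳ : ∀ {x} y → x ∈ I → x * y ∈ I
    *∈ʳ {x} y x∈ = ∈-resp I (*-comm y x) (*∈ I y x∈)

    1∈⇒⊇ : 1# ∈ I → ∀ r → r ∈ I
    1∈⇒⊇ 1∈ r = ∈-resp I (*-identityʳ r) (*∈ I r 1∈)

    prime-^-* : IsPrimeIdeal R I → ∀ {a} k {x} → a ^ k * x ∈ I → a ∈ I ⊎ x ∈ I
    prime-^-* _                 zero    akx∈ = inj₂ (∈-resp I (*-identityˡ _) akx∈)
    prime-^-* prime@(_ , split) (suc k) akx∈ =
      [ inj₁ , prime-^-* prime k ]′ (split _ _ (∈-resp I (*-assoc _ _ _) akx∈))

  span : ∀ {k} → Vector Carrier k → Ideal R L
  span {k} g = record
    { _∈ᴵ_   = ∈⟨_⟩ R g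
    ; ∈-resp = λ { x≈y (s , x≈) → s , trans (sym x≈y) x≈ }
    ; 0∈     = (λ _ → 0#) , 0≈
    ; +∈     = λ { (s , x≈) (t , y≈) → (λ j → s j + t j) , +≈ x≈ y≈ }
    ; *∈     = λ r → λ { (s , x≈) → (λ j → r * s j) , *≈ r x≈ }
    }
    where
    combination : Vector Carrier k → Carrier
    combination s = ∑ R k (λ j → s j * g j)

    0≈ : 0# ≈ combination (λ _ → 0#)
    0≈ = sym (∑-zeroˡ k g)

    +≈ : ∀ {x y s t} → x ≈ combination s → y ≈ combination t → x + y ≈ combination (λ j → s j + t j)
    +≈ {x} {y} {s} {t} x≈ y≈ = begin
      x + y                                ≈⟨ +-cong x≈ y≈ ⟩
      combination s + combination t        ≈⟨ ∑-distrib-+ k _ _ ⟨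
      ∑ R k (λ j → s j * g j + t j * g j)  ≈⟨ ∑-cong (λ j → distribʳ (g j) (s j) (t j)) ⟨
      combination (λ j → s j + t j)        ∎

    *≈ : ∀ r {x s} → x ≈ combination s → r * x ≈ combination (λ j → r * s j)
    *≈ r {x} {s} x≈ = begin
      r * x                          ≈⟨ *-congˡ x≈ ⟩
      r * combination s              ≈⟨ *-distribˡ-∑ k r _ ⟩
      ∑ R k (λ j → r * (s j * g j))  ≈⟨ ∑-cong (λ j → *-assoc r (s j) (g j)) ⟨
      combination (λ j → r * s j)    ∎

  span-tail⊆ : ∀ {k} (g : Vector Carrier (suc k)) → span (tail g) ⊆ span g
  span-tail⊆ g {r} (s , r≈) = (0# ∷ s) , (begin
    r                    ≈⟨ r≈ ⟩
    _                    ≈⟨ +-identityˡ _ ⟨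
    0# + _               ≈⟨ +-congʳ (zeroˡ (g fzero)) ⟨
    0# * g fzero + _     ∎)

  ∈-span : ∀ {k} (g : Vector Carrier k) j → g j ∈ span g
  ∈-span {suc k} g fzero    = (1# ∷ λ _ → 0#) , (begin
    g fzero                                  ≈⟨ +-identityʳ _ ⟨
    g fzero + 0#                             ≈⟨ +-cong (*-identityˡ _) (∑-zeroˡ k (tail g)) ⟨
    1# * g fzero + ∑ R k (λ j → 0# * g (fsuc j)) ∎)
  ∈-span {suc k} g (fsuc j) = span-tail⊆ g (∈-span (tail g) j)

  span-least : ∀ {p k} (I : Ideal R p) {g : Vector Carrier k} → (∀ j → g j ∈ I) → span g ⊆ I
  span-least {k = k} I {g} g∈ (s , r≈) = ∈-resp I (sym r≈) (∑-∈ I k (λ j → *∈ I (s j) (g∈ j)))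

  span-∷-* : ∀ {k} {g : Vector Carrier k} {a b x y} → a * b ∈ span g →
             x ∈ span (a ∷ g) → y ∈ span (b ∷ g) → x * y ∈ span g
  span-∷-* {k} {g} {a} {b} {x} {y} ab∈ (s , x≈) (t , y≈) =
    ∈-resp P (sym xy≈) (+∈ P (*∈ P (α * β) ab∈) (+∈ P (*∈ P (α * a) π′∈) (*∈ P (β * b + π′) π∈)))
    where
    P : Ideal R L
    P = span g

    α β π π′ : Carrier
    α = s fzero
    β = t fzero
    π = ∑ R k (λ j → s (fsuc j) * g j)
    π′ = ∑ R k (λ j → t (fsuc j) * g j)

    π∈ : π ∈ P
    π∈ = tail s , refl

    π′∈ : π′ ∈ P
    π′∈ = tail t , refl

    xy≈ : x * y ≈ (α * β) * (a * b) + ((α * a) * π′ + (β * b + π′) * π)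
    xy≈ = trans (*-cong x≈ y≈) (solve 6 (λ α a π β b π′ →
            (α :* a :+ π) :* (β :* b :+ π′) := (α :* β) :* (a :* b) :+ ((α :* a) :* π′ :+ (β :* b :+ π′) :* π))
            refl α a π β b π′)

  ChoiceMultiplier : ∀ {p n} → Ideal R p → Vector Carrier n → Set (L ⊔ p)
  ChoiceMultiplier {n = n} I x =
    Σ (Vector Carrier n) λ a → (∀ r → r ∈ span a) ×
    Σ Carrier λ i → i ∈ I × (∑ R n (λ j → a j * x j) ≈ 1# + i)

  ∑≈1⇒choiceMultiplier : ∀ {p n} (I : Ideal R p) {x s : Vector Carrier n} →
                         1# ≈ ∑ R n (λ j → s j * x j) → ChoiceMultiplier I x
  ∑≈1⇒choiceMultiplier {n = n} I {x} {s} 1≈ =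
    s , 1∈⇒⊇ (span s) (x , trans 1≈ (∑-cong (λ j → *-comm (s j) (x j)))) ,
    0# , 0∈ I , trans (sym 1≈) (sym (+-identityʳ 1#))

  span-of-zeros : ∀ {k} {g : Vector Carrier k} → (∀ j → g j ≈ 0#) → ∀ {r} → r ∈ span g → r ≈ 0#
  span-of-zeros {k} g≈0 (s , r≈) =
    trans r≈ (trans (∑-cong (λ j → trans (*-congˡ (g≈0 j)) (zeroʳ (s j)))) (∑-zero k))

  Avoids : ∀ {p q} → (Carrier → Set q) → Ideal R p → Set (c ⊔ p ⊔ q)
  Avoids S J = ∀ {s} → S s → ¬ s ∈ J

  IsFinitelyGenerated : ∀ {p} → Ideal R p → Set (L ⊔ p)
  IsFinitelyGenerated J =
    Σ ℕ λ n → Σ (Vector Carrier n) λ g → ∀ r → (r ∈ J → r ∈ span g) × (r ∈ span g → r ∈ J)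

  IsNoetherian : Set (Level.suc L)
  IsNoetherian = (J : Ideal R L) → IsFinitelyGenerated J

  record AvoidingPrime (S : Carrier → Set L) (J : Ideal R L) : Set L where
    field
      {size} : ℕ
      gens   : Vector Carrier size
      ⊇      : J ⊆ span gens
      avoids : Avoids S (span gens)
      prime  : IsPrimeIdeal R (span gens)

  module Noetherian (1≉0 : ¬ 1# ≈ 0#) (isNoetherian : IsNoetherian) where

    excludedMiddle : (P : Set L) → Dec P
    excludedMiddle P = decide (isNoetherian P∨≈0)
      where
      P∨≈0 : Ideal R L
      P∨≈0 = record
        { _∈ᴵ_   = λ r → P ⊎ r ≈ 0#
        ; ∈-resp = λ { _ (inj₁ p) → inj₁ p ; x≈y (inj₂ x≈0) → inj₂ (trans (sym x≈y) x≈0) }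
        ; 0∈     = inj₂ refl
        ; +∈     = λ { (inj₁ p) _ → inj₁ p ; (inj₂ _) (inj₁ p) → inj₁ p
                     ; (inj₂ x≈0) (inj₂ y≈0) → inj₂ (trans (+-cong x≈0 y≈0) (+-identityʳ 0#)) }
        ; *∈     = λ r → λ { (inj₁ p) → inj₁ p ; (inj₂ x≈0) → inj₂ (trans (*-congˡ x≈0) (zeroʳ r)) }
        }

      decide : IsFinitelyGenerated P∨≈0 → Dec P
      decide (_ , g , J≡span) with ∀⊎⇒⊎∀ (λ j → proj₂ (J≡span (g j)) (∈-span g j))
      ... | inj₁ p   = yes p
      ... | inj₂ g≈0 = no λ p → 1≉0 (span-of-zeros g≈0 (proj₁ (J≡span 1#) (inj₁ p)))

    ascendingChain-stabilises : (J : ℕ → Ideal R L) → (∀ m → J m ⊆ J (suc m)) →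
                                Σ ℕ λ M → J (suc M) ⊆ J M
    ascendingChain-stabilises J J⊆ = stabilise (isNoetherian ⋃)
      where
      mono : ∀ {m n} → m ≤′ n → J m ⊆ J n
      mono ≤′-refl        r∈ = r∈
      mono (≤′-step m≤′n) r∈ = J⊆ _ (mono m≤′n r∈)

      ⋃ : Ideal R L
      ⋃ = record
        { _∈ᴵ_   = λ r → Σ ℕ λ m → r ∈ J m
        ; ∈-resp = λ { x≈y (m , x∈) → m , ∈-resp (J m) x≈y x∈ }
        ; 0∈     = 0 , 0∈ (J 0)
        ; +∈     = λ { (m , x∈) (n , y∈) → m ⊔ℕ n ,
                       +∈ (J (m ⊔ℕ n)) (mono (≤⇒≤′ (m≤m⊔n m n)) x∈) (mono (≤⇒≤′ (m≤n⊔m m n)) y∈) }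
        ; *∈     = λ r → λ { (m , x∈) → m , *∈ (J m) r x∈ }
        }

      stabilise : IsFinitelyGenerated ⋃ → Σ ℕ λ M → J (suc M) ⊆ J M
      stabilise (_ , gens , ⋃≡span) = M , λ r∈ → span-least (J M) gens∈J-M (proj₁ (⋃≡span _) (suc M , r∈))
        where
        stage : ∀ j → Σ ℕ λ m → gens j ∈ J m
        stage j = proj₂ (⋃≡span (gens j)) (∈-span gens j)

        bound : Σ ℕ λ M → ∀ j → proj₁ (stage j) ≤ M
        bound = upperBound (proj₁ ∘ stage)

        M : ℕ
        M = proj₁ bound

        gens∈J-M : ∀ j → gens j ∈ J M
        gens∈J-M j = mono (≤⇒≤′ (proj₂ bound j)) (proj₂ (stage j))

    module _ (S : Carrier → Set L) (S-1 : S 1#) (S-* : ∀ {a b} → S a → S b → S (a * b)) where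

      private
        record Stage : Set L where
          constructor stage
          field
            {size} : ℕ
            gens   : Vector Carrier size
            avoids : Avoids S (span gens)
        open Stage

        Extension : Stage → Set L
        Extension σ = Σ Carrier λ r → ¬ r ∈ span (gens σ) × Avoids S (span (r ∷ gens σ))

        extend : (σ : Stage) → Dec (Extension σ) → Stage
        extend σ (yes (r , _ , av)) = stage (r ∷ gens σ) av
        extend σ (no _)             = σ

        span-extend : ∀ σ d → span (gens σ) ⊆ span (gens (extend σ d))
        span-extend σ (yes (r , _)) = span-tail⊆ (r ∷ gens σ)
        span-extend σ (no _)        = id

        extend-stuck : ∀ σ d → span (gens (extend σ d)) ⊆ span (gens σ) → ¬ Extension σ
        extend-stuck σ (yes (r , r∉ , _)) ⊆σ _ = r∉ (⊆σ (∈-span (r ∷ gens σ) fzero))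
        extend-stuck σ (no ¬ext)           _   = ¬ext

        grow : Stage → ℕ → Stage
        grow σ zero    = σ
        grow σ (suc m) = extend (grow σ m) (excludedMiddle (Extension (grow σ m)))

      -- Adjoin elements greedily while staying disjoint from S.  The chain stabilises at a stage
      -- that cannot be extended, and such a stage is prime: if a, b ∉ P, both P + aR and P + bR
      -- meet S, and the product of the two witnesses lies in P + abR.
      avoidingPrime : ∀ {k} (g : Vector Carrier k) → Avoids S (span g) → AvoidingPrime S (span g)
      avoidingPrime g avoidsS = record
        { gens   = gens P
        ; ⊇      = grow-⊇ M
        ; avoids = avoids P
        ; prime  = avoids P S-1 , split
        }
        where
        σ₀ : Stage
        σ₀ = stage g avoidsS

        J : ℕ → Ideal R L
        J m = span (gens (grow σ₀ m))

        J-step : ∀ m → J m ⊆ J (suc m)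
        J-step m = span-extend (grow σ₀ m) (excludedMiddle (Extension (grow σ₀ m)))

        grow-⊇ : ∀ m → span g ⊆ J m
        grow-⊇ zero    r∈ = r∈
        grow-⊇ (suc m) r∈ = J-step m (grow-⊇ m r∈)

        stable : Σ ℕ λ M → J (suc M) ⊆ J M
        stable = ascendingChain-stabilises J J-step

        M : ℕ
        M = proj₁ stable

        P : Stage
        P = grow σ₀ M

        saturated : ¬ Extension P
        saturated = extend-stuck P (excludedMiddle (Extension P)) (proj₂ stable)

        split : ∀ a b → a * b ∈ span (gens P) → a ∈ span (gens P) ⊎ b ∈ span (gens P)
        split a b ab∈ = decide (excludedMiddle (a ∈ span (gens P))) (excludedMiddle (b ∈ span (gens P)))
          where
          decide : Dec (a ∈ span (gens P)) → Dec (b ∈ span (gens P)) → a ∈ span (gens P) ⊎ b ∈ span (gens P)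
          decide (yes a∈) _        = inj₁ a∈
          decide (no _)   (yes b∈) = inj₂ b∈
          decide (no a∉)  (no b∉)  = ⊥-elim (saturated (a , a∉ , λ Sx x∈ →
                                       saturated (b , b∉ , λ Sy y∈ → avoids P (S-* Sx Sy) (span-∷-* ab∈ x∈ y∈))))

  Comaximal : Carrier → Carrier → Set L
  Comaximal x y = Σ Carrier λ p → Σ Carrier λ q → 1# ≈ p * x + q * y

  1∈span⇒comaximal : ∀ {x y} → 1# ∈ span (x ∷ y ∷ []) → Comaximal x y
  1∈span⇒comaximal (s , 1≈) = s fzero , s (fsuc fzero) , trans 1≈ (+-congˡ (+-identityʳ _))

  IsUnit : Carrier → Set L
  IsUnit x = _∣ᴿ_ R x 1#

  unit-* : ∀ {x y} → IsUnit x → IsUnit y → IsUnit (x * y)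
  unit-* {x} {y} (q , 1≈xq) (q′ , 1≈yq′) = q * q′ , (begin
    1#                ≈⟨ *-identityʳ 1# ⟨
    1# * 1#           ≈⟨ *-cong 1≈xq 1≈yq′ ⟩
    (x * q) * (y * q′) ≈⟨ *-interchange x q y q′ ⟩
    (x * y) * (q * q′) ∎)

  unit∈⇒1∈ : ∀ {p} (I : Ideal R p) {x} → IsUnit x → x ∈ I → 1# ∈ I
  unit∈⇒1∈ I (q , 1≈xq) x∈ = ∈-resp I (trans (*-comm q _) (sym 1≈xq)) (*∈ I q x∈)

module DedekindDomain {c ℓ : Level} (R : CommutativeRing c ℓ) (D : IsDedekindDomain R) where
  open CommutativeRing R
  open IsDedekindDomain D
  open RingTheory R
  open Noetherian 1≉0 noetherian
  open import Algebra.Properties.Semiring.Exp semiring using (_^_; ^-homo-*)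
  open import Algebra.Properties.Group +-group using (//-rightDividesˡ; x≈z//y)
  open import Algebra.Properties.CommutativeSemigroup *-commutativeSemigroup
    using () renaming (interchange to *-interchange)
  open import Algebra.Solver.Ring.NaturalCoefficients.Default commutativeSemiring
  open import Relation.Binary.Reasoning.Setoid setoid

  PowerTimesOneMod : Carrier → Carrier → Set L
  PowerTimesOneMod a s = Σ ℕ λ k → Σ Carrier λ y → Σ Carrier λ w → w + a * y ≈ 1# × s ≈ a ^ k * w

  oneMod-powerTimesOneMod : ∀ {a y w} → w + a * y ≈ 1# → PowerTimesOneMod a w
  oneMod-powerTimesOneMod {y = y} {w} w+ay≈1 = 0 , y , w , w+ay≈1 , sym (*-identityˡ w)

  1+a*0≈1 : ∀ a → 1# + a * 0# ≈ 1#
  1+a*0≈1 a = trans (+-congˡ (zeroʳ a)) (+-identityʳ 1#)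

  one-powerTimesOneMod : ∀ a → PowerTimesOneMod a 1#
  one-powerTimesOneMod a = oneMod-powerTimesOneMod (1+a*0≈1 a)

  self-powerTimesOneMod : ∀ a → PowerTimesOneMod a a
  self-powerTimesOneMod a = 1 , 0# , 1# , 1+a*0≈1 a , sym (trans (*-identityʳ (a * 1#)) (*-identityʳ a))

  powerTimesOneMod-* : ∀ {a s t} → PowerTimesOneMod a s → PowerTimesOneMod a t → PowerTimesOneMod a (s * t)
  powerTimesOneMod-* {a} {s} {t} (k , y , w , w+ay≈1 , s≈) (k′ , y′ , w′ , w′+ay′≈1 , t≈) =
    k +ℕ k′ , y * w′ + (w * y′ + a * (y * y′)) , w * w′ , ww′+a[…]≈1 , (begin
      s * t                        ≈⟨ *-cong s≈ t≈ ⟩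
      (a ^ k * w) * (a ^ k′ * w′)  ≈⟨ *-interchange (a ^ k) w (a ^ k′) w′ ⟩
      (a ^ k * a ^ k′) * (w * w′)  ≈⟨ *-congʳ (^-homo-* a k k′) ⟨
      a ^ (k +ℕ k′) * (w * w′)     ∎)
    where
    ww′+a[…]≈1 : w * w′ + a * (y * w′ + (w * y′ + a * (y * y′))) ≈ 1#
    ww′+a[…]≈1 = begin
      w * w′ + a * (y * w′ + (w * y′ + a * (y * y′)))
        ≈⟨ solve 5 (λ w y w′ y′ a → w :* w′ :+ a :* (y :* w′ :+ (w :* y′ :+ a :* (y :* y′)))
                                  := (w :+ a :* y) :* (w′ :+ a :* y′)) refl w y w′ y′ a ⟩
      (w + a * y) * (w′ + a * y′)  ≈⟨ *-cong w+ay≈1 w′+ay′≈1 ⟩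
      1# * 1#                      ≈⟨ *-identityʳ 1# ⟩
      1#                           ∎

  Meets : (Carrier → Set L) → Ideal R L → Set L
  Meets S J = Σ Carrier λ s → S s × s ∈ J

  -- R/c′R is strongly π-regular.  A prime P ⊇ c′R avoiding a^ℕ(1 + aR) would be maximal,
  -- and then P + aR = R puts an element of 1 + aR into P.
  stronglyπRegular : ∀ {c′} → ¬ c′ ≈ 0# → ∀ a → Meets (PowerTimesOneMod a) (span (c′ ∷ []))
  stronglyπRegular {c′} c′≉0 a = decide (excludedMiddle _)
    where
    S : Carrier → Set L
    S = PowerTimesOneMod a

    decide : Dec (Meets S (span (c′ ∷ []))) → Meets S (span (c′ ∷ []))
    decide (yes meets) = meets
    decide (no ¬meets) = ⊥-elim (absurd (avoidingPrime S (one-powerTimesOneMod a) powerTimesOneMod-*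
                                           (c′ ∷ []) λ Ss s∈ → ¬meets (_ , Ss , s∈)))
      where
      absurd : AvoidingPrime S (span (c′ ∷ [])) → ⊥
      absurd 𝔭 = escape (proj₂ (primeMax P (c′ , ⊇ (∈-span (c′ ∷ []) fzero) , c′≉0) prime)
                               (span (a ∷ gens)) (λ _ → span-tail⊆ (a ∷ gens)))
        where
        open AvoidingPrime 𝔭

        P : Ideal R L
        P = span gens

        escape : (∀ r → r ∈ span (a ∷ gens) → r ∈ P) ⊎ (∀ r → r ∈ span (a ∷ gens)) → ⊥
        escape (inj₁ P+a⊆P) = avoids (self-powerTimesOneMod a) (P+a⊆P a (∈-span (a ∷ gens) fzero))
        escape (inj₂ P+a≡R) with P+a≡R 1#
        ... | α , 1≈αa+π = avoids (oneMod-powerTimesOneMod π+aα≈1) (tail α , refl)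
          where
          π+aα≈1 : ∑ R _ (λ j → α (fsuc j) * gens j) + a * α fzero ≈ 1#
          π+aα≈1 = trans (+-comm _ _) (trans (+-congʳ (*-comm a (α fzero))) (sym 1≈αa+π))

  -- Take r = w β where c′ ∣ aᵏ w and w ∈ 1 + aR.  A prime containing a + r b and c′ contains aᵏ w,
  -- hence a or w, and either way both a and r b; then it contains w (α a + β b + γ c′) + a y = 1.
  stableRange₁ : ∀ {a b c′} → ¬ c′ ≈ 0# → ∀ α β γ → 1# ≈ α * a + β * b + γ * c′ →
                 Σ Carrier λ r → Comaximal (a + r * b) c′
  stableRange₁ {a} {b} {c′} c′≉0 α β γ 1≈ = choose (stronglyπRegular c′≉0 a)
    where
    choose : Meets (PowerTimesOneMod a) (span (c′ ∷ [])) → Σ Carrier λ r → Comaximal (a + r * b) c′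
    choose (s , (k , y , w , w+ay≈1 , s≈) , s∈) = w * β , decide (excludedMiddle _)
      where
      u : Carrier
      u = a + w * β * b

      decide : Dec (Comaximal u c′) → Comaximal u c′
      decide (yes comaximal) = comaximal
      decide (no ¬comaximal) =
        ⊥-elim (absurd (avoidingPrime IsUnit (1# , sym (*-identityˡ 1#)) unit-* (u ∷ c′ ∷ [])
                         λ unit s∈ → ¬comaximal (1∈span⇒comaximal (unit∈⇒1∈ (span (u ∷ c′ ∷ [])) unit s∈))))
        where
        absurd : AvoidingPrime IsUnit (span (u ∷ c′ ∷ [])) → ⊥
        absurd 𝔭 = proj₁ prime 1∈P
          where
          open AvoidingPrime 𝔭

          P : Ideal R L
          P = span gens

          u∈P : u ∈ P
          u∈P = ⊇ (∈-span (u ∷ c′ ∷ []) fzero)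

          c′∈P : c′ ∈ P
          c′∈P = ⊇ (∈-span (u ∷ c′ ∷ []) (fsuc fzero))

          a∈P : a ∈ P
          a∈P = [ id , (λ w∈P → +∈-cancelʳ P u∈P (*∈ʳ P b (*∈ʳ P β w∈P))) ]′
                  (prime-^-* P prime k (∈-resp P s≈ (span-least P {g = c′ ∷ []} (λ { fzero → c′∈P }) s∈)))

          1∈P : 1# ∈ P
          1∈P = ∈-resp P (sym 1≈[…])
                  (+∈ P (*∈ P (w * α + y) a∈P) (+∈ P (+∈-cancelˡ P u∈P a∈P) (*∈ P (w * γ) c′∈P)))
            where
            1≈[…] : 1# ≈ (w * α + y) * a + (w * β * b + (w * γ) * c′)
            1≈[…] = begin
              1#                                        ≈⟨ w+ay≈1 ⟨
              w + a * y                                 ≈⟨ +-congʳ (*-identityʳ w) ⟨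
              w * 1# + a * y                            ≈⟨ +-congʳ (*-congˡ 1≈) ⟩
              w * (α * a + β * b + γ * c′) + a * y
                ≈⟨ solve 8 (λ w α a β b γ c′ y →
                      w :* (α :* a :+ β :* b :+ γ :* c′) :+ a :* y
                      := (w :* α :+ y) :* a :+ (w :* β :* b :+ (w :* γ) :* c′)) refl w α a β b γ c′ y ⟩
              (w * α + y) * a + (w * β * b + (w * γ) * c′) ∎

  choiceMultiplier-regular : ∀ {p} (I : Ideal R p) {m} (x s : Vector Carrier (suc (suc m))) {i} →
                             i ∈ I → ¬ i ≈ 0# → 1# ≈ ∑ R (suc (suc m)) (λ j → s j * x j) + i →
                             ChoiceMultiplier I x
  choiceMultiplier-regular I {m} x s {i} i∈I i≉0 1≈ = choose (stableRange₁ i≉0 x₀ 1# 1# 1≈[…])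
    where
    s₀ x₀ s₁ x₁ B b : Carrier
    s₀ = s fzero
    x₀ = x fzero
    s₁ = s (fsuc fzero)
    x₁ = x (fsuc fzero)
    B = ∑ R m (λ j → s (fsuc (fsuc j)) * x (fsuc (fsuc j)))
    b = s₁ * x₁ + B

    1≈[…] : 1# ≈ x₀ * s₀ + 1# * b + 1# * i
    1≈[…] = trans 1≈ (solve 4 (λ s₀ x₀ b i → s₀ :* x₀ :+ b :+ i := x₀ :* s₀ :+ con 1 :* b :+ con 1 :* i)
                             refl s₀ x₀ b i)

    choose : Σ Carrier (λ r → Comaximal (s₀ + r * b) i) → ChoiceMultiplier I x
    choose (r , p , q , 1≈pu+qi) = t , 1∈⇒⊇ T 1∈T , i′ , i′∈I , ∑tx≈1+i′
      where
      u w V Y i′ : Carrier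
      u = s₀ + r * b
      w = 1# - r * x₀
      V = w * (p * u)

      -- V ≡ 1 − r x₀ (mod i), and i ∈ ⟨u, V s₁ + i⟩ since V is a multiple of u.
      t : Vector Carrier (suc (suc m))
      t = u ∷ (V * s₁ + i) ∷ (λ j → V * s (fsuc (fsuc j)))

      T : Ideal R L
      T = span t

      1∈T : 1# ∈ T
      1∈T = ∈-resp T (sym 1≈pu+qi) (+∈ T (*∈ T p u∈T) (*∈ T q i∈T))
        where
        u∈T : u ∈ T
        u∈T = ∈-span t fzero

        i∈T : i ∈ T
        i∈T = +∈-cancelˡ T (∈-span t (fsuc fzero)) (*∈ʳ T s₁ (*∈ T w (*∈ T p u∈T)))

      Y = w * q * b * i + i
      i′ = x₁ * i - Y

      i′∈I : i′ ∈ I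
      i′∈I = +∈ I (*∈ I x₁ i∈I) (-‿∈ I (+∈ I (*∈ I (w * q * b) i∈I) i∈I))

      ∑tx≈ : ∑ R (suc (suc m)) (λ j → t j * x j) ≈ u * x₀ + V * b + x₁ * i
      ∑tx≈ = begin
        u * x₀ + ((V * s₁ + i) * x₁ + ∑ R m (λ j → (V * s (fsuc (fsuc j))) * x (fsuc (fsuc j))))
          ≈⟨ +-congˡ (+-congˡ (∑-cong {m} (λ j → *-assoc V _ _))) ⟩
        u * x₀ + ((V * s₁ + i) * x₁ + ∑ R m (λ j → V * (s (fsuc (fsuc j)) * x (fsuc (fsuc j)))))
          ≈⟨ +-congˡ (+-congˡ (*-distribˡ-∑ m V _)) ⟨
        u * x₀ + ((V * s₁ + i) * x₁ + V * B)
          ≈⟨ solve 7 (λ u x₀ V s₁ i x₁ B → u :* x₀ :+ ((V :* s₁ :+ i) :* x₁ :+ V :* B)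
                                           := u :* x₀ :+ V :* (s₁ :* x₁ :+ B) :+ x₁ :* i) refl u x₀ V s₁ i x₁ B ⟩
        u * x₀ + V * b + x₁ * i ∎

      w[pu+qi]+rx₀≈1 : w * (p * u + q * i) + r * x₀ ≈ 1#
      w[pu+qi]+rx₀≈1 =
        trans (+-congʳ (trans (*-congˡ (sym 1≈pu+qi)) (*-identityʳ w))) (//-rightDividesˡ (r * x₀) 1#)

      ∑tx+Y≈1+x₁i : ∑ R (suc (suc m)) (λ j → t j * x j) + Y ≈ 1# + x₁ * i
      ∑tx+Y≈1+x₁i = begin
        ∑ R (suc (suc m)) (λ j → t j * x j) + Y                     ≈⟨ +-congʳ ∑tx≈ ⟩
        u * x₀ + V * b + x₁ * i + Y
          ≈⟨ solve 9 (λ s₀ x₀ r w p q i b x₁ →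
               (s₀ :+ r :* b) :* x₀ :+ w :* (p :* (s₀ :+ r :* b)) :* b :+ x₁ :* i :+ (w :* q :* b :* i :+ i)
               := s₀ :* x₀ :+ b :* (w :* (p :* (s₀ :+ r :* b) :+ q :* i) :+ r :* x₀) :+ i :+ x₁ :* i)
               refl s₀ x₀ r w p q i b x₁ ⟩
        s₀ * x₀ + b * (w * (p * u + q * i) + r * x₀) + i + x₁ * i
          ≈⟨ +-congʳ (+-congʳ (+-congˡ (trans (*-congˡ w[pu+qi]+rx₀≈1) (*-identityʳ b)))) ⟩
        s₀ * x₀ + b + i + x₁ * i                                    ≈⟨ +-congʳ 1≈ ⟨
        1# + x₁ * i                                                 ∎

      ∑tx≈1+i′ : ∑ R (suc (suc m)) (λ j → t j * x j) ≈ 1# + i′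
      ∑tx≈1+i′ = trans (x≈z//y _ Y _ ∑tx+Y≈1+x₁i) (+-assoc 1# (x₁ * i) (- Y))

  choiceMultiplier : ∀ {p} (I : Ideal R p) {m} (x : Vector Carrier (suc (suc m))) → ∈⟨_⟩+_ R x I 1# →
                     ChoiceMultiplier I x
  choiceMultiplier I x (s , i , i∈I , 1≈) = decide (excludedMiddle (Lift c (i ≈ 0#)))
    where
    decide : Dec (Lift c (i ≈ 0#)) → ChoiceMultiplier I x
    decide (yes (lift i≈0)) = ∑≈1⇒choiceMultiplier I {x} {s} (trans 1≈ (trans (+-congˡ i≈0) (+-identityʳ _)))
    decide (no i≉0)         = choiceMultiplier-regular I x s i∈I (i≉0 ∘ lift) 1≈

mainTheorem7 : ∀ {c ℓ : Level} (R : CommutativeRing c ℓ) → IsDedekindDomain R →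
    (I : Ideal R (c ⊔ ℓ)) → Proper R I →
    (n : ℕ) → 1 < n → (x : Fin n → CommutativeRing.Carrier R) →
    (∀ r → ∈⟨_⟩+_ R x I r) →
    Σ (Fin n → CommutativeRing.Carrier R) λ a →
    (∀ r → ∈⟨_⟩ R a r) ×
    Σ (CommutativeRing.Carrier R) λ i → _∈ᴵ_ I i ×
    CommutativeRing._≈_ R (∑ R n (λ j → CommutativeRing._*_ R (a j) (x j)))
    (CommutativeRing._+_ R (CommutativeRing.1# R) i)
mainTheorem7 R D I _ _ (s≤s (s≤s _)) x cover = DedekindDomain.choiceMultiplier R D I x (cover (CommutativeRing.1# R))
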